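{- The species $\mathfrak{o}$ of oriented trees and $\mathcal{O}$ of rooted oriented trees satisfy $\mathcal{O}=\mathfrak{o}+\mathcal{O}^2$, i.e. these species are naturally isomorphic.
   Context: Species are functors from the category of finite sets and bijections to itself; equality means natural isomorphism. $\mathfrak{o}[U]$ is the set of oriented trees on $U$: trees with vertex set $U$ in which each edge has been given an orientation. $\mathcal{O}=\mathfrak{o}^\bullet$ is the species of rooted oriented trees, i.e. $\mathcal{O}[U]=\{(t,u):t\in\mathfrak{o}[U],u\in U\}$. The sum is $(F+G)[U]=F[U]\sqcup G[U]$ and the product $(FG)[U]=\bigsqcup_{U_1\sqcup U_2=U}F[U_1]\times G[U_2]$ over ordered pairs of complementary subsets; $\mathcal{O}^2=\mathcal{O}\mathcal{O}$. Transports act by relabelling. -}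

module Defs where

open import Data.Nat using (ℕ)
open import Data.Fin using (Fin)
open import Data.Fin.Subset using (Subset; _∈_; _⊆_; _─_; ⊤; Nonempty)
open import Data.Fin.Permutation using (Permutation′; _⟨$⟩ʳ_; _⟨$⟩ˡ_)
open import Data.Vec using (Vec; lookup; tabulate)
open import Data.List using (List; []; _∷_)
open import Data.List.Relation.Unary.Unique.Propositional using (Unique)
open import Data.Product using (Σ; _×_; _,_; proj₁)
open import Data.Sum using (_⊎_; inj₁; inj₂)
open import Relation.Binary.PropositionalEquality using (_≡_)
open import Relation.Nullary using (¬_)

-- Species, presented on the skeleton of the groupoid of finite sets:
-- label sets are subsets U of Fin n (in particular the full set ⊤ = Fin n),
-- bijections are permutations of Fin n acting by relabelling.
--   Raw n        : underlying data of structures with labels in Fin n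
--   Str n U x    : x is an F-structure on the label set U ⊆ Fin n
--   relabel σ x  : transport of x along the bijection σ (relabelling)
-- Two structures are equal iff their underlying data are equal
-- (proof components are just membership conditions).

record Species : Set₁ where
  field
    Raw     : ℕ → Set
    Str     : (n : ℕ) → Subset n → Raw n → Set
    relabel : ∀ {n} → Permutation′ n → Raw n → Raw n

open Species public

_⟦_∣_⟧ : Species → (n : ℕ) → Subset n → Set
F ⟦ n ∣ U ⟧ = Σ (Raw F n) (Str F n U)

_⟦_⟧ : Species → ℕ → Set
F ⟦ n ⟧ = F ⟦ n ∣ ⊤ ⟧

relabelSubset : ∀ {n} → Permutation′ n → Subset n → Subset n
relabelSubset σ S = tabulate (λ i → lookup S (σ ⟨$⟩ˡ i))

_+ˢ_ : Species → Species → Species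
Raw (F +ˢ G) n = Raw F n ⊎ Raw G n
Str (F +ˢ G) n U (inj₁ x) = Str F n U x
Str (F +ˢ G) n U (inj₂ y) = Str G n U y
relabel (F +ˢ G) σ (inj₁ x) = inj₁ (relabel F σ x)
relabel (F +ˢ G) σ (inj₂ y) = inj₂ (relabel G σ y)

-- (FG)[U] = ⊔_{U₁ ⊔ U₂ = U} F[U₁] × G[U₂]  (ordered pairs; U₂ = U ─ U₁)
_·ˢ_ : Species → Species → Species
Raw (F ·ˢ G) n = Subset n × Raw F n × Raw G n
Str (F ·ˢ G) n U (U₁ , x , y) = U₁ ⊆ U × Str F n U₁ x × Str G n (U ─ U₁) y
relabel (F ·ˢ G) σ (U₁ , x , y) = relabelSubset σ U₁ , relabel F σ x , relabel G σ y

record NatIso (F G : Species) : Set where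
  field
    to      : ∀ n → F ⟦ n ⟧ → G ⟦ n ⟧
    from    : ∀ n → G ⟦ n ⟧ → F ⟦ n ⟧
    to-cong   : ∀ n (x y : F ⟦ n ⟧) → proj₁ x ≡ proj₁ y → proj₁ (to n x) ≡ proj₁ (to n y)
    from-cong : ∀ n (x y : G ⟦ n ⟧) → proj₁ x ≡ proj₁ y → proj₁ (from n x) ≡ proj₁ (from n y)
    from-to : ∀ n (x : F ⟦ n ⟧) → proj₁ (from n (to n x)) ≡ proj₁ x
    to-from : ∀ n (y : G ⟦ n ⟧) → proj₁ (to n (from n y)) ≡ proj₁ y
    natural : ∀ n (σ : Permutation′ n) (x y : F ⟦ n ⟧) →
              proj₁ y ≡ relabel F σ (proj₁ x) →
              proj₁ (to n y) ≡ relabel G σ (proj₁ (to n x))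

-- a directed graph on Fin n: E[u] is the set of out-neighbours of u
Digraph : ℕ → Set
Digraph n = Vec (Subset n) n

Edge : ∀ {n} → Digraph n → Fin n → Fin n → Set
Edge E u v = v ∈ lookup E u

Adj : ∀ {n} → Digraph n → Fin n → Fin n → Set
Adj E u v = Edge E u v ⊎ Edge E v u

data Walk {n} (E : Digraph n) : Fin n → Fin n → Set where
  stop : ∀ u → Walk E u u
  step : ∀ {u w v} → Adj E u w → Walk E w v → Walk E u v

vertices : ∀ {n} {E : Digraph n} {u v} → Walk E u v → List (Fin n)
vertices (stop u) = u ∷ []
vertices (step {u} _ p) = u ∷ vertices p

IsPath : ∀ {n} {E : Digraph n} {u v} → Walk E u v → Set
IsPath p = Unique (vertices p)

-- E is an oriented tree with vertex set U: its edges lie in U, each edge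
-- carries one orientation (no loops, no edge in both directions), and
-- the underlying simple graph is a tree on U (U nonempty, any two
-- vertices of U joined by exactly one path).
record IsOrientedTree (n : ℕ) (U : Subset n) (E : Digraph n) : Set where
  field
    edges-in   : ∀ u v → Edge E u v → u ∈ U × v ∈ U
    oriented   : ∀ u v → Edge E u v → ¬ Edge E v u
    nonempty   : Nonempty U
    connected  : ∀ u v → u ∈ U → v ∈ U → Σ (Walk E u v) IsPath
    uniquePath : ∀ u v (p q : Walk E u v) → IsPath p → IsPath q →
                 vertices p ≡ vertices q

relabelDigraph : ∀ {n} → Permutation′ n → Digraph n → Digraph n
relabelDigraph σ E = tabulate (λ i → relabelSubset σ (lookup E (σ ⟨$⟩ˡ i)))

𝔬 : Species
Raw 𝔬 n = Digraph n
Str 𝔬 n U E = IsOrientedTree n U E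
relabel 𝔬 σ E = relabelDigraph σ E

𝒪 : Species
Raw 𝒪 n = Digraph n × Fin n
Str 𝒪 n U (E , r) = IsOrientedTree n U E × r ∈ U
relabel 𝒪 σ (E , r) = relabelDigraph σ E , σ ⟨$⟩ʳ r

{-# OPTIONS --safe #-}
module Submission where

-- Orient every edge of an oriented tree towards the larger of the two components left by
-- deleting it, breaking ties by the edge's own orientation. A vertex r cannot point to two
-- neighbours x ≠ y: the x-side of r — x lies strictly inside the r-side of r — y and vice versa,
-- so the four side sizes would form a strictly increasing cycle. Following the pointers, the size
-- of the side left behind decreases, so there is a sink, and it is unique. A rooted oriented tree
-- whose root is the sink is just an oriented tree. Otherwise deleting the edge between the root
-- and the neighbour it points to leaves an ordered pair of rooted trees, rooted at the endpoints
-- and listed tail first. Conversely, the pair is grafted by an edge from the first root to the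
-- second and rooted at the endpoint on the lighter side. All choices depend only on the shape,
-- so the bijection commutes with relabelling.

open import Defs
open import Data.Nat as ℕ using (ℕ; suc; _≤_; _<_; s≤s; _≤?_)
import Data.Nat.Properties as ℕ
open import Data.Bool using (Bool; true; false)
open import Data.Fin using (Fin; zero; suc; _≟_)
open import Data.Fin.Properties using (any?)
open import Data.Fin.Permutation as Perm using (Permutation′; _⟨$⟩ʳ_; _⟨$⟩ˡ_; inverseˡ; inverseʳ)
open import Data.Fin.Subset using (Subset; _∈_; _∉_; _⊆_; _─_; ⊤; ∣_∣)
open import Data.Fin.Subset.Properties
  using (∈⊤; ⊆-antisym; x∈p∧x∉q⇒x∈p─q; p⊂q⇒∣p∣<∣q∣; ∣p∣≤n) renaming (_∈?_ to _∈ˢ?_)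
open import Data.Vec using (Vec; []; _∷_; lookup; tabulate; here; there)
open import Data.Vec.Properties using (lookup∘tabulate; []=⇒lookup; lookup⇒[]=)
open import Data.List using (List; []; _∷_; _++_; [_]; map)
open import Data.List.Properties using (++-assoc; ∷-injective; map-id)
open import Data.List.Membership.Propositional using () renaming (_∈_ to _∈ₗ_; _∉_ to _∉ₗ_)
open import Data.List.Membership.Propositional.Properties using (∈-++⁺ˡ; ∈-++⁺ʳ; ∈-++⁻; ∈-map⁺; ∈-map⁻)
open import Data.List.Relation.Unary.Any using (here; there)
open import Data.List.Relation.Unary.All as All using (All; []; _∷_)
open import Data.List.Relation.Unary.All.Properties as All using (¬Any⇒All¬; All¬⇒¬Any)
open import Data.List.Relation.Unary.AllPairs using ([]; _∷_)
open import Data.List.Relation.Unary.Unique.Propositional using (Unique)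
open import Data.List.Relation.Unary.Unique.Propositional.Properties as Unique
  using (Unique[x∷xs]⇒x∉xs)
open import Data.List.Relation.Binary.Disjoint.Propositional using (Disjoint)
open import Data.Product using (Σ; ∃; _×_; _,_; proj₁; proj₂)
open import Data.Sum using (_⊎_; inj₁; inj₂)
open import Data.Empty using (⊥; ⊥-elim)
open import Function using (_∘_; id; flip)
open import Relation.Nullary using (¬_; Dec; yes; no; does; ¬?)
open import Relation.Nullary.Decidable using (_×-dec_; _⊎-dec_; dec-true)
open import Relation.Binary.PropositionalEquality hiding ([_]; J)
import Algebra.Properties.CommutativeMonoid.Sum as CommutativeMonoidSum

subsetOf : ∀ {n} {P : Fin n → Set} → (∀ v → Dec (P v)) → Subset n
subsetOf P? = tabulate (does ∘ P?)

module _ {n} {P : Fin n → Set} (P? : ∀ v → Dec (P v)) where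

  ∈-subsetOf⁺ : ∀ {v} → P v → v ∈ subsetOf P?
  ∈-subsetOf⁺ {v} p = lookup⇒[]= v _ (trans (lookup∘tabulate _ v) (dec-true (P? v) p))

  ∈-subsetOf⁻ : ∀ {v} → v ∈ subsetOf P? → P v
  ∈-subsetOf⁻ {v} v∈ with P? v | trans (sym (lookup∘tabulate (does ∘ P?) v)) ([]=⇒lookup v∈)
  ... | yes p | _ = p

∈-⊤─⁺ : ∀ {n} {U : Subset n} {v} → v ∉ U → v ∈ ⊤ ─ U
∈-⊤─⁺ = x∈p∧x∉q⇒x∈p─q ∈⊤

∈-⊤─⁻ : ∀ {n} (U : Subset n) {v} → v ∈ ⊤ ─ U → v ∉ U
∈-⊤─⁻ (false ∷ U) here        ()
∈-⊤─⁻ (_ ∷ U)     (there v∈) (there v∈U) = ∈-⊤─⁻ U v∈ v∈U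

Edge? : ∀ {n} (E : Digraph n) u v → Dec (Edge E u v)
Edge? E u v = v ∈ˢ? lookup E u

digraphOf : ∀ {n} {R : Fin n → Fin n → Set} → (∀ u v → Dec (R u v)) → Digraph n
digraphOf R? = tabulate (subsetOf ∘ R?)

module _ {n} {R : Fin n → Fin n → Set} (R? : ∀ u v → Dec (R u v)) where

  edge-digraphOf⁺ : ∀ {u v} → R u v → Edge (digraphOf R?) u v
  edge-digraphOf⁺ {u} r = subst (_ ∈_) (sym (lookup∘tabulate _ u)) (∈-subsetOf⁺ (R? u) r)

  edge-digraphOf⁻ : ∀ {u v} → Edge (digraphOf R?) u v → R u v
  edge-digraphOf⁻ {u} e = ∈-subsetOf⁻ (R? u) (subst (_ ∈_) (lookup∘tabulate _ u) e)

digraph-ext : ∀ {n m} {E E′ : Vec (Subset n) m} →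
              (∀ u v → v ∈ lookup E u → v ∈ lookup E′ u) →
              (∀ u v → v ∈ lookup E′ u → v ∈ lookup E u) → E ≡ E′
digraph-ext {E = []}    {[]}      _ _ = refl
digraph-ext {E = s ∷ E} {t ∷ E′} f g =
  cong₂ _∷_ (⊆-antisym (f zero _) (g zero _)) (digraph-ext (f ∘ suc) (g ∘ suc))

Unique-∷⁺ : ∀ {A : Set} {x : A} {xs} → x ∉ₗ xs → Unique xs → Unique (x ∷ xs)
Unique-∷⁺ {xs = xs} x∉ u = ¬Any⇒All¬ xs x∉ ∷ u

Unique-++⁻ : ∀ {A : Set} (xs : List A) {ys} → Unique (xs ++ ys) →
             Unique xs × Unique ys × Disjoint xs ys
Unique-++⁻ []       u = [] , u , λ ()
Unique-++⁻ (x ∷ xs) (x∉ ∷ u) with Unique-++⁻ xs u | All.++⁻ xs x∉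
... | uxs , uys , disj | x∉xs , x∉ys =
  x∉xs ∷ uxs , uys , λ { (here refl , v∈ys) → All¬⇒¬Any x∉ys v∈ys
                       ; (there v∈xs , v∈ys) → disj (v∈xs , v∈ys) }

Closed : ∀ {n} → Digraph n → Subset n → Set
Closed E X = ∀ u v → Edge E u v → u ∈ X × v ∈ X

Adj-sym : ∀ {n} (E : Digraph n) {u v} → Adj E u v → Adj E v u
Adj-sym _ (inj₁ e) = inj₂ e
Adj-sym _ (inj₂ e) = inj₁ e

Adj-closed : ∀ {n} {E : Digraph n} {X} → Closed E X → ∀ {u w} → Adj E u w → u ∈ X × w ∈ X
Adj-closed cl (inj₁ e) = cl _ _ e
Adj-closed cl (inj₂ e) = let u∈ , w∈ = cl _ _ e in w∈ , u∈

module Walks {n} {E : Digraph n} where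

  initials : ∀ {u v} → Walk E u v → List (Fin n)
  initials (stop u)       = []
  initials (step {u} _ p) = u ∷ initials p

  vertices-initials : ∀ {u v} (p : Walk E u v) → vertices p ≡ initials p ++ [ v ]
  vertices-initials (stop u)       = refl
  vertices-initials (step {u} _ p) = cong (u ∷_) (vertices-initials p)

  infixr 5 _++ʷ_
  _++ʷ_ : ∀ {u w v} → Walk E u w → Walk E w v → Walk E u v
  stop _   ++ʷ q = q
  step e p ++ʷ q = step e (p ++ʷ q)

  vertices-++ʷ : ∀ {u w v} (p : Walk E u w) (q : Walk E w v) →
                 vertices (p ++ʷ q) ≡ initials p ++ vertices q
  vertices-++ʷ (stop _)       q = refl
  vertices-++ʷ (step {u} e p) q = cong (u ∷_) (vertices-++ʷ p q)

  first∈vertices : ∀ {u v} (p : Walk E u v) → u ∈ₗ vertices p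
  first∈vertices (stop u)   = here refl
  first∈vertices (step e p) = here refl

  last∈vertices : ∀ {u v} (p : Walk E u v) → v ∈ₗ vertices p
  last∈vertices (stop u)   = here refl
  last∈vertices (step e p) = there (last∈vertices p)

  vertices-∷ : ∀ {u v} (p : Walk E u v) → ∃ λ xs → vertices p ≡ u ∷ xs
  vertices-∷ (stop u)   = [] , refl
  vertices-∷ (step e p) = vertices p , refl

  splitAt : ∀ {u v w} (p : Walk E u v) → w ∈ₗ vertices p →
            Σ (Walk E u w) λ p₁ → Σ (Walk E w v) λ p₂ → vertices p ≡ initials p₁ ++ vertices p₂
  splitAt (stop u)       (here refl) = stop u , stop u , refl
  splitAt (step e p)     (here refl) = stop _ , step e p , refl
  splitAt (step {u} e p) (there w∈)  =
    let p₁ , p₂ , eq = splitAt p w∈ in step e p₁ , p₂ , cong (u ∷_) eq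

  suffixPath : ∀ {u v w} (p : Walk E u v) → IsPath p → w ∈ₗ vertices p →
               Σ (Walk E w v) λ p₂ → IsPath p₂ × (∀ {x} → x ∈ₗ vertices p₂ → x ∈ₗ vertices p)
  suffixPath p p-path w∈ =
    let p₁ , p₂ , eq = splitAt p w∈ in
    p₂ , proj₁ (proj₂ (Unique-++⁻ (initials p₁) (subst Unique eq p-path))) ,
    λ x∈ → subst (_ ∈ₗ_) (sym eq) (∈-++⁺ʳ (initials p₁) x∈)

  prefixPath : ∀ {u v w} (p : Walk E u v) → IsPath p → w ∈ₗ vertices p →
               Σ (Walk E u w) λ p₁ → IsPath p₁ ×
                 (∀ {x} → x ∈ₗ vertices p₁ → x ≡ w ⊎ (x ∈ₗ vertices p × x ≢ v))
  prefixPath p p-path w∈ with splitAt p w∈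
  ... | p₁ , p₂ , eq with Unique-++⁻ (initials p₁) (subst Unique eq p-path)
  ... | init-path , _ , disj = p₁ , p₁-path , located
    where
    p₁-path : IsPath p₁
    p₁-path = subst Unique (sym (vertices-initials p₁))
      (Unique.++⁺ init-path ([] ∷ []) λ { (x∈ , here refl) → disj (x∈ , first∈vertices p₂) })
    located : ∀ {x} → x ∈ₗ vertices p₁ → _
    located x∈ with ∈-++⁻ (initials p₁) (subst (_ ∈ₗ_) (vertices-initials p₁) x∈)
    ... | inj₂ (here refl) = inj₁ refl
    ... | inj₁ x∈init      = inj₂ (subst (_ ∈ₗ_) (sym eq) (∈-++⁺ˡ x∈init) ,
                                   λ { refl → disj (x∈init , last∈vertices p₂) })

  mapWalk : ∀ {m} {E′ : Digraph m} (f : Fin n → Fin m) → (∀ {x y} → Adj E x y → Adj E′ (f x) (f y)) →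
            ∀ {u v} → Walk E u v → Walk E′ (f u) (f v)
  mapWalk f g (stop u)   = stop (f u)
  mapWalk f g (step e p) = step (g e) (mapWalk f g p)

  vertices-mapWalk : ∀ {m} {E′ : Digraph m} (f : Fin n → Fin m)
                     (g : ∀ {x y} → Adj E x y → Adj E′ (f x) (f y)) →
                     ∀ {u v} (p : Walk E u v) → vertices (mapWalk {E′ = E′} f g p) ≡ map f (vertices p)
  vertices-mapWalk f g (stop u)       = refl
  vertices-mapWalk f g (step {u} e p) = cong (f u ∷_) (vertices-mapWalk f g p)

  liftWalk : ∀ {E′ : Digraph n} → (∀ {x y} → Adj E x y → Adj E′ x y) → ∀ {u v} → Walk E u v → Walk E′ u v
  liftWalk {E′} = mapWalk {E′ = E′} id

  vertices-liftWalk : ∀ {E′ : Digraph n} (g : ∀ {x y} → Adj E x y → Adj E′ x y) →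
                      ∀ {u v} (p : Walk E u v) → vertices (liftWalk g p) ≡ vertices p
  vertices-liftWalk {E′} g p = trans (vertices-mapWalk {E′ = E′} id g p) (map-id (vertices p))

  All-vertices-closed : ∀ {X} → Closed E X → ∀ {u v} (p : Walk E u v) → u ∈ X → All (_∈ X) (vertices p)
  All-vertices-closed cl (stop u)   u∈ = u∈ ∷ []
  All-vertices-closed cl (step e p) u∈ = u∈ ∷ All-vertices-closed cl p (proj₂ (Adj-closed {E = E} cl e))

  last-closed : ∀ {X} → Closed E X → ∀ {u v} (p : Walk E u v) → u ∈ X → v ∈ X
  last-closed cl p u∈ = All.lookup (All-vertices-closed cl p u∈) (last∈vertices p)

induced : ∀ {n} → Digraph n → Subset n → Digraph n
induced E W = digraphOf (λ u v → u ∈ˢ? W ×-dec (v ∈ˢ? W ×-dec Edge? E u v))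

module _ {n} (E : Digraph n) (W : Subset n) where

  edge-induced⁺ : ∀ {u v} → u ∈ W → v ∈ W → Edge E u v → Edge (induced E W) u v
  edge-induced⁺ u∈ v∈ e = edge-digraphOf⁺ (λ u v → u ∈ˢ? W ×-dec (v ∈ˢ? W ×-dec Edge? E u v)) (u∈ , v∈ , e)

  edge-induced⁻ : ∀ {u v} → Edge (induced E W) u v → u ∈ W × v ∈ W × Edge E u v
  edge-induced⁻ = edge-digraphOf⁻ (λ u v → u ∈ˢ? W ×-dec (v ∈ˢ? W ×-dec Edge? E u v))

  Adj-induced⁻ : ∀ {u v} → Adj (induced E W) u v → Adj E u v
  Adj-induced⁻ (inj₁ e) = inj₁ (proj₂ (proj₂ (edge-induced⁻ e)))
  Adj-induced⁻ (inj₂ e) = inj₂ (proj₂ (proj₂ (edge-induced⁻ e)))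

  induced-closed : Closed (induced E W) W
  induced-closed u v e = let u∈ , v∈ , _ = edge-induced⁻ e in u∈ , v∈

-- Graphs made of two parts joined by a single bridge a — b

SplitsAt : ∀ {n} → Digraph n → Digraph n → Digraph n → Fin n → Fin n → Set
SplitsAt J EA EB a b = ∀ {u w} → Adj J u w →
  Adj EA u w ⊎ Adj EB u w ⊎ (u ≡ a × w ≡ b) ⊎ (u ≡ b × w ≡ a)

SplitsAt-swap : ∀ {n} {J EA EB : Digraph n} {a b} → SplitsAt J EA EB a b → SplitsAt J EB EA b a
SplitsAt-swap split e with split e
... | inj₁ x                 = inj₂ (inj₁ x)
... | inj₂ (inj₁ x)          = inj₁ x
... | inj₂ (inj₂ (inj₁ x))   = inj₂ (inj₂ (inj₂ x))
... | inj₂ (inj₂ (inj₂ x))   = inj₂ (inj₂ (inj₁ x))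

UniquePaths : ∀ {n} → Digraph n → Set
UniquePaths E = ∀ {x y} (p q : Walk E x y) → IsPath p → IsPath q → vertices p ≡ vertices q

module Exit {n} (J EA EB : Digraph n) (A B : Subset n) (a b : Fin n)
  (split : SplitsAt J EA EB a b) (closedA : Closed EA A) (closedB : Closed EB B)
  (disjoint : ∀ {v} → v ∈ A → v ∈ B → ⊥) (a∈A : a ∈ A) (b∈B : b ∈ B) where

  open Walks

  exit : ∀ {u v} (p : Walk J u v) → u ∈ A →
           (Σ (Walk EA u v) λ q → vertices q ≡ vertices p) ⊎
           (Σ (Walk EA u a) λ q → Σ (Walk J b v) λ r → vertices p ≡ vertices q ++ vertices r)
  exit (stop u) _ = inj₁ (stop u , refl)
  exit (step {u} e p) u∈A with split e
  ... | inj₁ eA with exit p (proj₂ (Adj-closed {E = EA} closedA eA))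
  ...   | inj₁ (q , eq)     = inj₁ (step eA q , cong (u ∷_) eq)
  ...   | inj₂ (q , r , eq) = inj₂ (step eA q , r , cong (u ∷_) eq)
  exit (step e p) u∈A | inj₂ (inj₁ eB) = ⊥-elim (disjoint u∈A (proj₁ (Adj-closed {E = EB} closedB eB)))
  exit (step e p) u∈A | inj₂ (inj₂ (inj₁ (refl , refl))) = inj₂ (stop a , p , refl)
  exit (step e p) u∈A | inj₂ (inj₂ (inj₂ (refl , refl))) = ⊥-elim (disjoint u∈A b∈B)

module Bridge {n} (J EA EB : Digraph n) (A B : Subset n) (a b : Fin n)
  (split : SplitsAt J EA EB a b) (closedA : Closed EA A) (closedB : Closed EB B)
  (disjoint : ∀ {v} → v ∈ A → v ∈ B → ⊥) (a∈A : a ∈ A) (b∈B : b ∈ B) where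

  open Walks
  private
    module fromA = Exit J EA EB A B a b split closedA closedB disjoint a∈A b∈B
    module fromB = Exit J EB EA B A b a (SplitsAt-swap {J = J} {EA} {EB} split) closedB closedA (flip disjoint) b∈B a∈A

  path-decompose : ∀ {u v} (p : Walk J u v) → IsPath p → u ∈ A →
                   (Σ (Walk EA u v) λ q → vertices q ≡ vertices p) ⊎
                   (Σ (Walk EA u a) λ q → Σ (Walk EB b v) λ r → vertices p ≡ vertices q ++ vertices r)
  path-decompose p p-path u∈A with fromA.exit p u∈A
  ... | inj₁ stays = inj₁ stays
  ... | inj₂ (q , r , eq) with fromB.exit r b∈B
  ...   | inj₁ (r′ , eq′) = inj₂ (q , r′ , trans eq (cong (vertices q ++_) (sym eq′)))
  ...   | inj₂ (q′ , r′ , eq′) =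
    ⊥-elim (proj₂ (proj₂ (Unique-++⁻ (vertices q) (subst Unique eq p-path)))
             (last∈vertices q , subst (_ ∈ₗ_) (sym eq′) (∈-++⁺ʳ (vertices q′) (first∈vertices r′))))

  uniquePath-from-A : UniquePaths EA → UniquePaths EB →
                      ∀ {u v} (p q : Walk J u v) → IsPath p → IsPath q → u ∈ A → vertices p ≡ vertices q
  uniquePath-from-A uniqueA uniqueB p q p-path q-path u∈A
    with path-decompose p p-path u∈A | path-decompose q q-path u∈A
  ... | inj₁ (p′ , eqp) | inj₁ (q′ , eqq) =
    trans (sym eqp) (trans (uniqueA p′ q′ (subst Unique (sym eqp) p-path) (subst Unique (sym eqq) q-path)) eqq)
  ... | inj₂ (p₁ , p₂ , eqp) | inj₂ (q₁ , q₂ , eqq) =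
    let p₁-path , p₂-path , _ = Unique-++⁻ (vertices p₁) (subst Unique eqp p-path)
        q₁-path , q₂-path , _ = Unique-++⁻ (vertices q₁) (subst Unique eqq q-path)
    in trans eqp (trans (cong₂ _++_ (uniqueA p₁ q₁ p₁-path q₁-path) (uniqueB p₂ q₂ p₂-path q₂-path)) (sym eqq))
  ... | inj₁ (p′ , _) | inj₂ (_ , q₂ , _) =
    ⊥-elim (disjoint (last-closed closedA p′ u∈A) (last-closed closedB q₂ b∈B))
  ... | inj₂ (_ , p₂ , _) | inj₁ (q′ , _) =
    ⊥-elim (disjoint (last-closed closedA q′ u∈A) (last-closed closedB p₂ b∈B))

  path-across : (∀ {x y} → Adj EA x y → Adj J x y) → (∀ {x y} → Adj EB x y → Adj J x y) → Adj J a b →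
                ∀ {u v} (p : Walk EA u a) (q : Walk EB b v) → IsPath p → IsPath q → u ∈ A →
                Σ (Walk J u v) IsPath
  path-across liftA liftB bridge p q p-path q-path u∈A =
    w , subst Unique (sym vertices-w) (Unique.++⁺ p-path q-path disj)
    where
    p′ = liftWalk liftA p
    q′ = liftWalk liftB q
    w  = p′ ++ʷ step bridge q′
    vertices-w : vertices w ≡ vertices p ++ vertices q
    vertices-w = begin
      vertices w                              ≡⟨ vertices-++ʷ p′ (step bridge q′) ⟩
      initials p′ ++ a ∷ vertices q′           ≡⟨ ++-assoc (initials p′) [ a ] (vertices q′) ⟨
      (initials p′ ++ [ a ]) ++ vertices q′    ≡⟨ cong (_++ vertices q′) (vertices-initials p′) ⟨
      vertices p′ ++ vertices q′               ≡⟨ cong₂ _++_ (vertices-liftWalk liftA p) (vertices-liftWalk liftB q) ⟩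
      vertices p ++ vertices q                 ∎
      where open ≡-Reasoning
    disj : Disjoint (vertices p) (vertices q)
    disj (x∈p , x∈q) = disjoint (All.lookup (All-vertices-closed closedA p u∈A) x∈p)
                                (All.lookup (All-vertices-closed closedB q b∈B) x∈q)

-- The two sides of an edge of a tree

module Sides {n} {E : Digraph n} (T : IsOrientedTree n ⊤ E) where
  open IsOrientedTree T
  open Walks
  open import Data.List.Membership.DecPropositional (_≟_ {n}) using () renaming (_∈?_ to _∈ₗ?_)

  path : ∀ u v → Walk E u v
  path u v = proj₁ (connected u v ∈⊤ ∈⊤)

  path-isPath : ∀ u v → IsPath (path u v)
  path-isPath u v = proj₂ (connected u v ∈⊤ ∈⊤)

  route : Fin n → Fin n → List (Fin n)
  route u v = vertices (path u v)

  route-unique : ∀ {u v} (q : Walk E u v) → IsPath q → vertices q ≡ route u v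
  route-unique {u} {v} q q-path = uniquePath u v q (path u v) q-path (path-isPath u v)

  Adj⇒≢ : ∀ {x y} → Adj E x y → x ≢ y
  Adj⇒≢ (inj₁ e) refl = oriented _ _ e e
  Adj⇒≢ (inj₂ e) refl = oriented _ _ e e

  route-refl : ∀ a → route a a ≡ a ∷ []
  route-refl a = sym (route-unique (stop a) ([] ∷ []))

  route-edge : ∀ {a b} → Adj E a b → route a b ≡ a ∷ b ∷ []
  route-edge e = sym (route-unique (step e (stop _)) (Unique-∷⁺ (λ { (here a≡b) → Adj⇒≢ e a≡b }) ([] ∷ [])))

  route-snoc : ∀ v {a b} → Adj E a b → b ∉ₗ route v a → route v b ≡ route v a ++ [ b ]
  route-snoc v {a} {b} e b∉ = trans (sym (route-unique w w-path)) vertices-w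
    where
    w = path v a ++ʷ step e (stop b)
    vertices-w : vertices w ≡ route v a ++ [ b ]
    vertices-w = begin
      vertices w                              ≡⟨ vertices-++ʷ (path v a) (step e (stop b)) ⟩
      initials (path v a) ++ a ∷ [ b ]        ≡⟨ ++-assoc (initials (path v a)) [ a ] [ b ] ⟨
      (initials (path v a) ++ [ a ]) ++ [ b ] ≡⟨ cong (_++ [ b ]) (vertices-initials (path v a)) ⟨
      route v a ++ [ b ]                      ∎
      where open ≡-Reasoning
    w-path : IsPath w
    w-path = subst Unique (sym vertices-w)
      (Unique.++⁺ (path-isPath v a) ([] ∷ []) λ { (x∈ , here refl) → b∉ x∈ })

  route-suffix : ∀ {u w a} → w ∈ₗ route u a → ∀ {x} → x ∈ₗ route w a → x ∈ₗ route u a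
  route-suffix {u} {w} {a} w∈ x∈ =
    let q , q-path , q⊆ = suffixPath (path u a) (path-isPath u a) w∈
    in q⊆ (subst (_ ∈ₗ_) (sym (route-unique q q-path)) x∈)

  ∉route⇒∈route : ∀ v {a b} → Adj E a b → b ∉ₗ route v a → a ∈ₗ route v b
  ∉route⇒∈route v e b∉ = subst (_ ∈ₗ_) (sym (route-snoc v e b∉)) (∈-++⁺ˡ (last∈vertices (path v _)))

  ∈route⇒∉route : ∀ v {a b} → Adj E a b → b ∈ₗ route v a → a ∉ₗ route v b
  ∈route⇒∉route v {a} e b∈ a∈ with prefixPath (path v a) (path-isPath v a) b∈
  ... | q , q-path , located with located (subst (a ∈ₗ_) (sym (route-unique q q-path)) a∈)
  ...   | inj₁ a≡b       = Adj⇒≢ e a≡b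
  ...   | inj₂ (_ , a≢a) = a≢a refl

  side : Fin n → Fin n → Subset n
  side a b = subsetOf (λ v → ¬? (b ∈ₗ? route v a))

  ∈side⁺ : ∀ {a b v} → b ∉ₗ route v a → v ∈ side a b
  ∈side⁺ {a} {b} = ∈-subsetOf⁺ (λ v → ¬? (b ∈ₗ? route v a))

  ∈side⁻ : ∀ {a b v} → v ∈ side a b → b ∉ₗ route v a
  ∈side⁻ {a} {b} = ∈-subsetOf⁻ (λ v → ¬? (b ∈ₗ? route v a))

  ∉side⇒∈route : ∀ {a b v} → v ∉ side a b → b ∈ₗ route v a
  ∉side⇒∈route {a} {b} {v} v∉ with b ∈ₗ? route v a
  ... | yes b∈ = b∈
  ... | no  b∉ = ⊥-elim (v∉ (∈side⁺ b∉))

  ⊤─side : ∀ {a b} → Adj E a b → ⊤ ─ side a b ≡ side b a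
  ⊤─side {a} {b} e = ⊆-antisym
    (λ v∈ → ∈side⁺ (∈route⇒∉route _ e (∉side⇒∈route (∈-⊤─⁻ (side a b) v∈))))
    (λ v∈ → ∈-⊤─⁺ λ v∈′ → ∈side⁻ v∈ (∉route⇒∈route _ e (∈side⁻ v∈′)))

  ∈side-self : ∀ {a b} → Adj E a b → a ∈ side a b
  ∈side-self e = ∈side⁺ (subst (_ ∉ₗ_) (sym (route-refl _)) λ { (here b≡a) → Adj⇒≢ e (sym b≡a) })

  ∉side-other : ∀ {a b} → b ∉ side a b
  ∉side-other b∈ = ∈side⁻ b∈ (first∈vertices (path _ _))

  crossing-edge : ∀ {a b x y} → Adj E a b → Adj E x y → x ∈ side a b → y ∉ side a b → x ≡ a × y ≡ b
  crossing-edge {a} {b} {x} {y} eab exy x∈ y∉ with y ∈ₗ? route x a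
  ... | yes y∈ = ⊥-elim (∈side⁻ x∈ (route-suffix y∈ (∉side⇒∈route y∉)))
  ... | no  y∉route = x≡a , y≡b
    where
    b∉ : b ∉ₗ route x a
    b∉ = ∈side⁻ x∈
    route-y : route y a ≡ y ∷ route x a
    route-y = sym (route-unique (step (Adj-sym E exy) (path x a)) (Unique-∷⁺ y∉route (path-isPath x a)))
    y≡b : y ≡ b
    y≡b with subst (b ∈ₗ_) route-y (∉side⇒∈route y∉)
    ... | here b≡y  = sym b≡y
    ... | there b∈  = ⊥-elim (b∉ b∈)
    route-b : b ∷ route x a ≡ b ∷ a ∷ []
    route-b = trans (route-unique (step (subst (λ z → Adj E z x) y≡b (Adj-sym E exy)) (path x a))
                                  (Unique-∷⁺ b∉ (path-isPath x a)))
                    (route-edge (Adj-sym E eab))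
    x≡a : x ≡ a
    x≡a = let xs , eq = vertices-∷ (path x a) in
          proj₁ (∷-injective (trans (sym eq) (proj₂ (∷-injective route-b))))

  induced-isTree : ∀ {a b} → Adj E a b → (A : Subset n) → side a b ⊆ A → A ⊆ side a b →
                   IsOrientedTree n A (induced E A)
  induced-isTree {a} {b} eab A side⊆A A⊆side = record
    { edges-in   = induced-closed E A
    ; oriented   = λ u v e e′ → oriented u v (edge-in-E e) (edge-in-E e′)
    ; nonempty   = a , a∈A
    ; connected  = connectedA
    ; uniquePath = λ u v p q p-path q-path →
        let lift = liftWalk (Adj-induced⁻ E A)
            lift-vertices = vertices-liftWalk (Adj-induced⁻ E A)
        in trans (sym (lift-vertices p))
             (trans (uniquePath u v (lift p) (lift q) (subst Unique (sym (lift-vertices p)) p-path)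
                                                      (subst Unique (sym (lift-vertices q)) q-path))
                    (lift-vertices q))
    }
    where
    B = ⊤ ─ A
    EA = induced E A
    EB = induced E B

    edge-in-E : ∀ {u v} → Edge EA u v → Edge E u v
    edge-in-E e = proj₂ (proj₂ (edge-induced⁻ E A e))

    a∈A : a ∈ A
    a∈A = side⊆A (∈side-self eab)

    b∈B : b ∈ B
    b∈B = ∈-⊤─⁺ (∉side-other ∘ A⊆side)

    disjoint : ∀ {v} → v ∈ A → v ∈ B → ⊥
    disjoint v∈A v∈B = ∈-⊤─⁻ A v∈B v∈A

    induce : ∀ (W : Subset n) {u w} → u ∈ W → w ∈ W → Adj E u w → Adj (induced E W) u w
    induce W u∈ w∈ (inj₁ e) = inj₁ (edge-induced⁺ E W u∈ w∈ e)
    induce W u∈ w∈ (inj₂ e) = inj₂ (edge-induced⁺ E W w∈ u∈ e)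

    split : SplitsAt E EA EB a b
    split {u} {w} e with u ∈ˢ? A | w ∈ˢ? A
    ... | yes u∈ | yes w∈ = inj₁ (induce A u∈ w∈ e)
    ... | no  u∉ | no  w∉ = inj₂ (inj₁ (induce B (∈-⊤─⁺ u∉) (∈-⊤─⁺ w∉) e))
    ... | yes u∈ | no  w∉ = inj₂ (inj₂ (inj₁ (crossing-edge eab e (A⊆side u∈) (w∉ ∘ side⊆A))))
    ... | no  u∉ | yes w∈ =
      let w≡a , u≡b = crossing-edge eab (Adj-sym E e) (A⊆side w∈) (u∉ ∘ side⊆A)
      in inj₂ (inj₂ (inj₂ (u≡b , w≡a)))

    open Bridge E EA EB A B a b split (induced-closed E A) (induced-closed E B) disjoint a∈A b∈B

    connectedA : ∀ u v → u ∈ A → v ∈ A → Σ (Walk EA u v) IsPath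
    connectedA u v u∈ v∈ with path-decompose (path u v) (path-isPath u v) u∈
    ... | inj₁ (q , eq)     = q , subst Unique (sym eq) (path-isPath u v)
    ... | inj₂ (_ , r , _)  = ⊥-elim (disjoint v∈ (last-closed (induced-closed E B) r b∈B))

-- Orienting every edge of a tree towards its heavier side

module Heavier {n} {E : Digraph n} (T : IsOrientedTree n ⊤ E) where
  open IsOrientedTree T
  open Sides T
  open Walks

  size : Fin n → Fin n → ℕ
  size a b = ∣ side a b ∣

  Toward : Fin n → Fin n → Set
  Toward a b = (Edge E a b × size a b ≤ size b a) ⊎ (Edge E b a × size a b < size b a)

  Toward? : ∀ a b → Dec (Toward a b)
  Toward? a b = (Edge? E a b ×-dec (size a b ≤? size b a)) ⊎-dec (Edge? E b a ×-dec (suc (size a b) ≤? size b a))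

  Toward⇒Adj : ∀ {a b} → Toward a b → Adj E a b
  Toward⇒Adj (inj₁ (e , _)) = inj₁ e
  Toward⇒Adj (inj₂ (e , _)) = inj₂ e

  Toward⇒≤ : ∀ {a b} → Toward a b → size a b ≤ size b a
  Toward⇒≤ (inj₁ (_ , le)) = le
  Toward⇒≤ (inj₂ (_ , lt)) = ℕ.<⇒≤ lt

  Toward-asym : ∀ {a b} → Toward a b → ¬ Toward b a
  Toward-asym (inj₁ (e , _)) (inj₁ (e′ , _)) = oriented _ _ e e′
  Toward-asym (inj₁ (_ , le)) (inj₂ (_ , lt))  = ℕ.<⇒≱ lt le
  Toward-asym (inj₂ (_ , lt)) (inj₁ (_ , le))  = ℕ.<⇒≱ lt le
  Toward-asym (inj₂ (e , _)) (inj₂ (e′ , _)) = oriented _ _ e′ e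

  Toward-total : ∀ {a b} → Adj E a b → Toward a b ⊎ Toward b a
  Toward-total {a} {b} (inj₁ e) with size a b ≤? size b a
  ... | yes le = inj₁ (inj₁ (e , le))
  ... | no  ≰ = inj₂ (inj₂ (e , ℕ.≰⇒> ≰))
  Toward-total {a} {b} (inj₂ e) with size b a ≤? size a b
  ... | yes le = inj₂ (inj₁ (e , le))
  ... | no  ≰ = inj₁ (inj₂ (e , ℕ.≰⇒> ≰))

  side-shrinks : ∀ {r x y} → Adj E r x → Adj E r y → x ≢ y → size y r < size r x
  side-shrinks {r} {x} {y} erx ery x≢y =
    p⊂q⇒∣p∣<∣q∣ (side⊆side , r , ∈side-self erx , ∉side-other)
    where
    route-xy : route x y ≡ x ∷ r ∷ y ∷ []
    route-xy = sym (route-unique (step (Adj-sym E erx) (step ery (stop y)))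
      (Unique-∷⁺ (λ { (here x≡r) → Adj⇒≢ erx (sym x≡r) ; (there (here x≡y)) → x≢y x≡y })
        (Unique-∷⁺ (λ { (here r≡y) → Adj⇒≢ ery r≡y }) ([] ∷ []))))
    side⊆side : side y r ⊆ side r x
    side⊆side {v} v∈ = ∈side⁺ x∉
      where
      r∉ : r ∉ₗ route v y
      r∉ = ∈side⁻ v∈
      x∉ : x ∉ₗ route v r
      x∉ x∈ with ∈-++⁻ (route v y) (subst (x ∈ₗ_) (route-snoc v (Adj-sym E ery) r∉) x∈)
      ... | inj₂ (here x≡r) = Adj⇒≢ erx (sym x≡r)
      ... | inj₁ x∈route    = r∉ (route-suffix x∈route (subst (r ∈ₗ_) (sym route-xy) (there (here refl))))

  Toward-functional : ∀ {r x y} → Toward r x → Toward r y → x ≡ y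
  Toward-functional {r} {x} {y} r→x r→y with x ≟ y
  ... | yes x≡y = x≡y
  ... | no  x≢y = ⊥-elim (ℕ.<-irrefl refl (begin-strict
    size r x  ≤⟨ Toward⇒≤ r→x ⟩
    size x r  <⟨ side-shrinks ery erx (x≢y ∘ sym) ⟩
    size r y  ≤⟨ Toward⇒≤ r→y ⟩
    size y r  <⟨ side-shrinks erx ery x≢y ⟩
    size r x  ∎))
    where
    open ℕ.≤-Reasoning
    erx = Toward⇒Adj r→x
    ery = Toward⇒Adj r→y

  IsSink : Fin n → Set
  IsSink c = ∀ w → ¬ Toward c w

  -- As u already points to w, every edge of a path leaving u away from w points back
  -- towards u (Toward-functional), so the far end still points somewhere.
  ¬IsSink-beyond : ∀ {u v} w → Toward u w → (p : Walk E u v) → Unique (w ∷ vertices p) → ¬ IsSink v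
  ¬IsSink-beyond w u→w (stop u) _ sink = sink w u→w
  ¬IsSink-beyond {u} w u→w (step {w = x} e q) unique@(_ ∷ unique′) sink with Toward? u x
  ... | yes u→x = Unique[x∷xs]⇒x∉xs unique
                    (subst (_∈ₗ u ∷ vertices q) (Toward-functional u→x u→w) (there (first∈vertices q)))
  ... | no ¬u→x with Toward-total e
  ...   | inj₁ u→x = ¬u→x u→x
  ...   | inj₂ x→u = ¬IsSink-beyond u x→u q unique′ sink

  sink-unique : ∀ {c c′} → IsSink c → IsSink c′ → c ≡ c′
  sink-unique {c} {c′} c-sink c′-sink with connected c c′ ∈⊤ ∈⊤
  ... | stop _ , _ = refl
  ... | step {w = x} e q , p-path with Toward-total e
  ...   | inj₁ c→x = ⊥-elim (c-sink x c→x)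
  ...   | inj₂ x→c = ⊥-elim (¬IsSink-beyond c x→c q p-path c′-sink)

  sink-or-step : ∀ x → IsSink x ⊎ ∃ (Toward x)
  sink-or-step x with any? (Toward? x)
  ... | yes x→ = inj₂ x→
  ... | no ¬x→ = inj₁ λ w x→w → ¬x→ (w , x→w)

  -- Along a Toward-walk r → x → y the side size x r strictly decreases.
  descend : ∀ k {r x} → Toward r x → size x r < k → Σ (Fin n) IsSink
  descend (suc k) {r} {x} r→x size<k with sink-or-step x
  ... | inj₁ x-sink     = x , x-sink
  ... | inj₂ (y , x→y) =
    descend k x→y (ℕ.<-≤-trans (side-shrinks (Adj-sym E (Toward⇒Adj r→x)) (Toward⇒Adj x→y) r≢y) (ℕ.≤-pred size<k))
    where
    r≢y : r ≢ y
    r≢y refl = Toward-asym r→x x→y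

  sink : Σ (Fin n) IsSink
  sink with sink-or-step (proj₁ nonempty)
  ... | inj₁ v-sink       = _ , v-sink
  ... | inj₂ (x , v→x)    = descend (suc n) v→x (s≤s (∣p∣≤n (side x _)))

-- Grafting two trees together along a new edge a → b

GraftEdge : ∀ {n} → Digraph n → Digraph n → Fin n → Fin n → Fin n → Fin n → Set
GraftEdge E₁ E₂ a b u v = Edge E₁ u v ⊎ Edge E₂ u v ⊎ (u ≡ a × v ≡ b)

graft : ∀ {n} → Digraph n → Digraph n → Fin n → Fin n → Digraph n
graft E₁ E₂ a b = digraphOf λ u v → Edge? E₁ u v ⊎-dec (Edge? E₂ u v ⊎-dec (u ≟ a ×-dec v ≟ b))

module _ {n} (E₁ E₂ : Digraph n) (a b : Fin n) where

  edge-graft⁺ : ∀ {u v} → GraftEdge E₁ E₂ a b u v → Edge (graft E₁ E₂ a b) u v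
  edge-graft⁺ = edge-digraphOf⁺ λ u v → Edge? E₁ u v ⊎-dec (Edge? E₂ u v ⊎-dec (u ≟ a ×-dec v ≟ b))

  edge-graft⁻ : ∀ {u v} → Edge (graft E₁ E₂ a b) u v → GraftEdge E₁ E₂ a b u v
  edge-graft⁻ = edge-digraphOf⁻ λ u v → Edge? E₁ u v ⊎-dec (Edge? E₂ u v ⊎-dec (u ≟ a ×-dec v ≟ b))

module Graft {n} (U : Subset n) (E₁ E₂ : Digraph n) (a b : Fin n)
  (T₁ : IsOrientedTree n U E₁) (T₂ : IsOrientedTree n (⊤ ─ U) E₂) (a∈ : a ∈ U) (b∈ : b ∈ ⊤ ─ U) where

  open Walks
  private
    module T₁ = IsOrientedTree T₁
    module T₂ = IsOrientedTree T₂
    J : Digraph n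
    J = graft E₁ E₂ a b

  edge-ab : Edge J a b
  edge-ab = edge-graft⁺ E₁ E₂ a b (inj₂ (inj₂ (refl , refl)))

  private
    disjoint : ∀ {v} → v ∈ U → v ∈ ⊤ ─ U → ⊥
    disjoint v∈ v∈′ = ∈-⊤─⁻ U v∈′ v∈

    split : SplitsAt J E₁ E₂ a b
    split (inj₁ e) with edge-graft⁻ E₁ E₂ a b e
    ... | inj₁ e₁         = inj₁ (inj₁ e₁)
    ... | inj₂ (inj₁ e₂)  = inj₂ (inj₁ (inj₁ e₂))
    ... | inj₂ (inj₂ ab)  = inj₂ (inj₂ (inj₁ ab))
    split (inj₂ e) with edge-graft⁻ E₁ E₂ a b e
    ... | inj₁ e₁               = inj₁ (inj₂ e₁)
    ... | inj₂ (inj₁ e₂)        = inj₂ (inj₁ (inj₂ e₂))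
    ... | inj₂ (inj₂ (p , q))   = inj₂ (inj₂ (inj₂ (q , p)))

    lift₁ : ∀ {x y} → Adj E₁ x y → Adj J x y
    lift₁ (inj₁ e) = inj₁ (edge-graft⁺ E₁ E₂ a b (inj₁ e))
    lift₁ (inj₂ e) = inj₂ (edge-graft⁺ E₁ E₂ a b (inj₁ e))

    lift₂ : ∀ {x y} → Adj E₂ x y → Adj J x y
    lift₂ (inj₁ e) = inj₁ (edge-graft⁺ E₁ E₂ a b (inj₂ (inj₁ e)))
    lift₂ (inj₂ e) = inj₂ (edge-graft⁺ E₁ E₂ a b (inj₂ (inj₁ e)))

    module fromU = Bridge J E₁ E₂ U (⊤ ─ U) a b split T₁.edges-in T₂.edges-in disjoint a∈ b∈
    module from∁U = Bridge J E₂ E₁ (⊤ ─ U) U b a (SplitsAt-swap {J = J} {E₁} {E₂} split)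
                      T₂.edges-in T₁.edges-in (flip disjoint) b∈ a∈

    liftPath : ∀ {E′ : Digraph n} → (∀ {x y} → Adj E′ x y → Adj J x y) →
               ∀ {u v} → Σ (Walk E′ u v) IsPath → Σ (Walk J u v) IsPath
    liftPath g (p , p-path) = liftWalk g p , subst Unique (sym (vertices-liftWalk g p)) p-path

    oriented : ∀ u v → Edge J u v → ¬ Edge J v u
    oriented u v e e′ with edge-graft⁻ E₁ E₂ a b e | edge-graft⁻ E₁ E₂ a b e′
    ... | inj₁ x                   | inj₁ y                   = T₁.oriented u v x y
    ... | inj₁ x                   | inj₂ (inj₁ y)            = disjoint (proj₂ (T₁.edges-in u v x)) (proj₁ (T₂.edges-in v u y))
    ... | inj₁ x                   | inj₂ (inj₂ (refl , refl)) = disjoint (proj₁ (T₁.edges-in u v x)) b∈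
    ... | inj₂ (inj₁ x)            | inj₁ y                   = disjoint (proj₁ (T₁.edges-in v u y)) (proj₂ (T₂.edges-in u v x))
    ... | inj₂ (inj₁ x)            | inj₂ (inj₁ y)            = T₂.oriented u v x y
    ... | inj₂ (inj₁ x)            | inj₂ (inj₂ (refl , refl)) = disjoint a∈ (proj₂ (T₂.edges-in u v x))
    ... | inj₂ (inj₂ (refl , refl)) | inj₁ y                   = disjoint (proj₁ (T₁.edges-in v u y)) b∈
    ... | inj₂ (inj₂ (refl , refl)) | inj₂ (inj₁ y)            = disjoint a∈ (proj₂ (T₂.edges-in v u y))
    ... | inj₂ (inj₂ (refl , refl)) | inj₂ (inj₂ (refl , _))   = disjoint a∈ b∈

    connected : ∀ u v → u ∈ ⊤ → v ∈ ⊤ → Σ (Walk J u v) IsPath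
    connected u v _ _ with u ∈ˢ? U | v ∈ˢ? U
    ... | yes u∈ | yes v∈ = liftPath lift₁ (T₁.connected u v u∈ v∈)
    ... | no  u∉ | no  v∉ = liftPath lift₂ (T₂.connected u v (∈-⊤─⁺ u∉) (∈-⊤─⁺ v∉))
    ... | yes u∈ | no  v∉ =
      let p , p-path = T₁.connected u a u∈ a∈
          q , q-path = T₂.connected b v b∈ (∈-⊤─⁺ v∉)
      in fromU.path-across lift₁ lift₂ (inj₁ edge-ab) p q p-path q-path u∈
    ... | no  u∉ | yes v∈ =
      let p , p-path = T₂.connected u b (∈-⊤─⁺ u∉) b∈
          q , q-path = T₁.connected a v a∈ v∈
      in from∁U.path-across lift₂ lift₁ (inj₂ edge-ab) p q p-path q-path (∈-⊤─⁺ u∉)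

  graft-isTree : IsOrientedTree n ⊤ J
  graft-isTree = record
    { edges-in   = λ _ _ _ → ∈⊤ , ∈⊤
    ; oriented   = oriented
    ; nonempty   = a , ∈⊤
    ; connected  = connected
    ; uniquePath = λ u v p q p-path q-path → case-on u p q p-path q-path
    }
    where
    case-on : ∀ u {v} (p q : Walk J u v) → IsPath p → IsPath q → vertices p ≡ vertices q
    case-on u p q p-path q-path with u ∈ˢ? U
    ... | yes u∈ = fromU.uniquePath-from-A (T₁.uniquePath _ _) (T₂.uniquePath _ _) p q p-path q-path u∈
    ... | no  u∉ = from∁U.uniquePath-from-A (T₂.uniquePath _ _) (T₁.uniquePath _ _) p q p-path q-path (∈-⊤─⁺ u∉)

  open Sides graft-isTree using (side; path; path-isPath; route-unique; ∈side⁺; ∈side⁻)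

  side-graft : side a b ≡ U
  side-graft = ⊆-antisym side⊆U U⊆side
    where
    U⊆side : U ⊆ side a b
    U⊆side {v} v∈ = ∈side⁺ λ b∈route →
      let p , p-path = T₁.connected v a v∈ a∈
          route≡ = trans (sym (vertices-liftWalk lift₁ p))
                         (route-unique (liftWalk lift₁ p) (subst Unique (sym (vertices-liftWalk lift₁ p)) p-path))
      in disjoint (All.lookup (All-vertices-closed T₁.edges-in p v∈) (subst (b ∈ₗ_) (sym route≡) b∈route)) b∈
    side⊆U : side a b ⊆ U
    side⊆U {v} v∈ with v ∈ˢ? U
    ... | yes v∈U = v∈U
    ... | no  v∉U with from∁U.path-decompose (path v a) (path-isPath v a) (∈-⊤─⁺ v∉U)
    ...   | inj₁ (q , _)      = ⊥-elim (disjoint a∈ (last-closed T₂.edges-in q (∈-⊤─⁺ v∉U)))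
    ...   | inj₂ (q , _ , eq) = ⊥-elim (∈side⁻ v∈ (subst (b ∈ₗ_) (sym eq) (∈-++⁺ˡ (last∈vertices q))))

  induced-graft₁ : induced J U ≡ E₁
  induced-graft₁ = digraph-ext to from
    where
    to : ∀ u v → Edge (induced J U) u v → Edge E₁ u v
    to u v e with edge-induced⁻ J U e
    ... | u∈ , v∈ , e′ with edge-graft⁻ E₁ E₂ a b e′
    ...   | inj₁ e₁                   = e₁
    ...   | inj₂ (inj₁ e₂)            = ⊥-elim (disjoint u∈ (proj₁ (T₂.edges-in u v e₂)))
    ...   | inj₂ (inj₂ (refl , refl)) = ⊥-elim (disjoint v∈ b∈)
    from : ∀ u v → Edge E₁ u v → Edge (induced J U) u v
    from u v e = let u∈ , v∈ = T₁.edges-in u v e in edge-induced⁺ J U u∈ v∈ (edge-graft⁺ E₁ E₂ a b (inj₁ e))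

  induced-graft₂ : induced J (⊤ ─ U) ≡ E₂
  induced-graft₂ = digraph-ext to from
    where
    to : ∀ u v → Edge (induced J (⊤ ─ U)) u v → Edge E₂ u v
    to u v e with edge-induced⁻ J (⊤ ─ U) e
    ... | u∈ , v∈ , e′ with edge-graft⁻ E₁ E₂ a b e′
    ...   | inj₁ e₁                   = ⊥-elim (disjoint (proj₁ (T₁.edges-in u v e₁)) u∈)
    ...   | inj₂ (inj₁ e₂)            = e₂
    ...   | inj₂ (inj₂ (refl , refl)) = ⊥-elim (disjoint a∈ u∈)
    from : ∀ u v → Edge E₂ u v → Edge (induced J (⊤ ─ U)) u v
    from u v e = let u∈ , v∈ = T₂.edges-in u v e in edge-induced⁺ J (⊤ ─ U) u∈ v∈ (edge-graft⁺ E₁ E₂ a b (inj₂ (inj₁ e)))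

module _ {n} {E : Digraph n} (T : IsOrientedTree n ⊤ E) where
  open IsOrientedTree T
  open Sides T

  graft-sides : ∀ {a b} → Edge E a b → graft (induced E (side a b)) (induced E (⊤ ─ side a b)) a b ≡ E
  graft-sides {a} {b} eab = digraph-ext to from
    where
    A = side a b
    B = ⊤ ─ side a b
    to : ∀ u v → Edge (graft (induced E A) (induced E B) a b) u v → Edge E u v
    to u v e with edge-graft⁻ (induced E A) (induced E B) a b e
    ... | inj₁ eA                   = proj₂ (proj₂ (edge-induced⁻ E A eA))
    ... | inj₂ (inj₁ eB)            = proj₂ (proj₂ (edge-induced⁻ E B eB))
    ... | inj₂ (inj₂ (refl , refl)) = eab
    from : ∀ u v → Edge E u v → Edge (graft (induced E A) (induced E B) a b) u v
    from u v e with u ∈ˢ? A | v ∈ˢ? A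
    ... | yes u∈ | yes v∈ = edge-graft⁺ (induced E A) (induced E B) a b (inj₁ (edge-induced⁺ E A u∈ v∈ e))
    ... | no  u∉ | no  v∉ = edge-graft⁺ (induced E A) (induced E B) a b (inj₂ (inj₁ (edge-induced⁺ E B (∈-⊤─⁺ u∉) (∈-⊤─⁺ v∉) e)))
    ... | yes u∈ | no  v∉ with crossing-edge (inj₁ eab) (inj₁ e) u∈ v∉
    ...   | refl , refl = edge-graft⁺ (induced E A) (induced E B) a b (inj₂ (inj₂ (refl , refl)))
    from u v e | no u∉ | yes v∈ with crossing-edge (inj₁ eab) (inj₂ e) v∈ u∉
    ...   | refl , refl = ⊥-elim (oriented a b eab e)

module _ {n} (σ : Permutation′ n) where

  ∈-relabelSubset⁺ : ∀ {X v} → σ ⟨$⟩ˡ v ∈ X → v ∈ relabelSubset σ X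
  ∈-relabelSubset⁺ {X} {v} v∈ = lookup⇒[]= v _ (trans (lookup∘tabulate _ v) ([]=⇒lookup v∈))

  ∈-relabelSubset⁻ : ∀ {X v} → v ∈ relabelSubset σ X → σ ⟨$⟩ˡ v ∈ X
  ∈-relabelSubset⁻ {X} {v} v∈ = lookup⇒[]= (σ ⟨$⟩ˡ v) X (trans (sym (lookup∘tabulate _ v)) ([]=⇒lookup v∈))

  relabelSubset-⊤─ : ∀ X → relabelSubset σ (⊤ ─ X) ≡ ⊤ ─ relabelSubset σ X
  relabelSubset-⊤─ X = ⊆-antisym
    (λ v∈ → ∈-⊤─⁺ λ v∈′ → ∈-⊤─⁻ X (∈-relabelSubset⁻ v∈) (∈-relabelSubset⁻ v∈′))
    (λ v∈ → ∈-relabelSubset⁺ (∈-⊤─⁺ λ v∈′ → ∈-⊤─⁻ (relabelSubset σ X) v∈ (∈-relabelSubset⁺ v∈′)))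

  edge-relabel⁺ : ∀ (E : Digraph n) {u v} → Edge E (σ ⟨$⟩ˡ u) (σ ⟨$⟩ˡ v) → Edge (relabelDigraph σ E) u v
  edge-relabel⁺ E {u} e = subst (_ ∈_) (sym (lookup∘tabulate _ u)) (∈-relabelSubset⁺ e)

  edge-relabel⁻ : ∀ (E : Digraph n) {u v} → Edge (relabelDigraph σ E) u v → Edge E (σ ⟨$⟩ˡ u) (σ ⟨$⟩ˡ v)
  edge-relabel⁻ E {u} e = ∈-relabelSubset⁻ (subst (_ ∈_) (lookup∘tabulate _ u) e)

  edge-relabel : ∀ (E : Digraph n) {u v} → Edge E u v → Edge (relabelDigraph σ E) (σ ⟨$⟩ʳ u) (σ ⟨$⟩ʳ v)
  edge-relabel E e = edge-relabel⁺ E (subst₂ (Edge E) (sym (inverseˡ σ)) (sym (inverseˡ σ)) e)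

  edge-unrelabel : ∀ (E : Digraph n) {u v} → Edge (relabelDigraph σ E) (σ ⟨$⟩ʳ u) (σ ⟨$⟩ʳ v) → Edge E u v
  edge-unrelabel E e = subst₂ (Edge E) (inverseˡ σ) (inverseˡ σ) (edge-relabel⁻ E e)

  ∣relabelSubset∣ : ∀ X → ∣ relabelSubset σ X ∣ ≡ ∣ X ∣
  ∣relabelSubset∣ X = begin
    ∣ relabelSubset σ X ∣                         ≡⟨ ∣p∣≡sum (relabelSubset σ X) ⟩
    sum (indicator ∘ lookup (relabelSubset σ X))  ≡⟨ sum-cong-≗ (cong indicator ∘ lookup∘tabulate (lookup X ∘ (σ ⟨$⟩ˡ_))) ⟩
    sum (λ i → indicator (lookup X (σ ⟨$⟩ˡ i)))   ≡⟨ sum-permute (indicator ∘ lookup X) (Perm.flip σ) ⟨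
    sum (indicator ∘ lookup X)                    ≡⟨ ∣p∣≡sum X ⟨
    ∣ X ∣                                         ∎
    where
    open ≡-Reasoning
    open CommutativeMonoidSum ℕ.+-0-commutativeMonoid using (sum; sum-cong-≗; sum-permute)
    indicator : Bool → ℕ
    indicator true  = 1
    indicator false = 0
    ∣p∣≡sum : ∀ {m} (p : Subset m) → ∣ p ∣ ≡ sum (indicator ∘ lookup p)
    ∣p∣≡sum []          = refl
    ∣p∣≡sum (true ∷ p)  = cong suc (∣p∣≡sum p)
    ∣p∣≡sum (false ∷ p) = ∣p∣≡sum p

relabelSubset-id : ∀ {n} (X : Subset n) → relabelSubset Perm.id X ≡ X
relabelSubset-id X = ⊆-antisym (∈-relabelSubset⁻ Perm.id) (∈-relabelSubset⁺ Perm.id)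

relabelDigraph-id : ∀ {n} (E : Digraph n) → relabelDigraph Perm.id E ≡ E
relabelDigraph-id E = digraph-ext (λ _ _ → edge-relabel⁻ Perm.id E) (λ _ _ → edge-relabel⁺ Perm.id E)

𝔬+𝒪² : Species
𝔬+𝒪² = 𝔬 +ˢ (𝒪 ·ˢ 𝒪)

module _ {n} {E : Digraph n} (T : IsOrientedTree n ⊤ E) where
  open Sides T
  open Heavier T

  cut : ∀ {a b} → Edge E a b → 𝔬+𝒪² ⟦ n ⟧
  cut {a} {b} e =
    inj₂ (side a b , (induced E (side a b) , a) , (induced E (⊤ ─ side a b) , b)) ,
    (λ _ → ∈⊤) ,
    (induced-isTree (inj₁ e) (side a b) id id , ∈side-self (inj₁ e)) ,
    (induced-isTree (inj₂ e) (⊤ ─ side a b) (subst (_ ∈_) (sym ⊤─side≡)) (subst (_ ∈_) ⊤─side≡) ,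
     ∈-⊤─⁺ ∉side-other)
    where
    ⊤─side≡ : ⊤ ─ side a b ≡ side b a
    ⊤─side≡ = ⊤─side (inj₁ e)

  cutToward : ∀ {r w} → Toward r w → 𝔬+𝒪² ⟦ n ⟧
  cutToward (inj₁ (e , _)) = cut e
  cutToward (inj₂ (e , _)) = cut e

  classify : ∀ {r} → IsSink r ⊎ ∃ (Toward r) → 𝔬+𝒪² ⟦ n ⟧
  classify (inj₁ _)       = inj₁ E , T
  classify (inj₂ (_ , t)) = cutToward t

  classify-sink : ∀ {r} (d : IsSink r ⊎ ∃ (Toward r)) → IsSink r → proj₁ (classify d) ≡ inj₁ E
  classify-sink (inj₁ _)         _      = refl
  classify-sink (inj₂ (w , r→w)) r-sink = ⊥-elim (r-sink w r→w)

  classify-step : ∀ {r w} (d : IsSink r ⊎ ∃ (Toward r)) (t : Toward r w) → proj₁ (classify d) ≡ proj₁ (cutToward t)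
  classify-step (inj₁ r-sink)    t = ⊥-elim (r-sink _ t)
  classify-step (inj₂ (_ , t′)) t with Toward-functional t′ t
  classify-step (inj₂ (_ , inj₁ _))       (inj₁ _)        | refl = refl
  classify-step (inj₂ (_ , inj₂ _))       (inj₂ _)        | refl = refl
  classify-step (inj₂ (_ , inj₁ (e , _))) (inj₂ (e′ , _)) | refl = ⊥-elim (IsOrientedTree.oriented T _ _ e e′)
  classify-step (inj₂ (_ , inj₂ (e , _))) (inj₁ (e′ , _)) | refl = ⊥-elim (IsOrientedTree.oriented T _ _ e e′)

module Transport {n} {E E′ : Digraph n} (T : IsOrientedTree n ⊤ E) (T′ : IsOrientedTree n ⊤ E′)
  (σ : Permutation′ n)
  (edge⇒ : ∀ {u v} → Edge E u v → Edge E′ (σ ⟨$⟩ʳ u) (σ ⟨$⟩ʳ v))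
  (edge⇐ : ∀ {u v} → Edge E′ (σ ⟨$⟩ʳ u) (σ ⟨$⟩ʳ v) → Edge E u v) where

  open Walks
  private
    module S  = Sides T
    module S′ = Sides T′
    module H  = Heavier T
    module H′ = Heavier T′

    σʳ σˡ : Fin n → Fin n
    σʳ = σ ⟨$⟩ʳ_
    σˡ = σ ⟨$⟩ˡ_

    σʳ-injective : ∀ {x y} → σʳ x ≡ σʳ y → x ≡ y
    σʳ-injective {x} {y} eq = trans (sym (inverseˡ σ)) (trans (cong σˡ eq) (inverseˡ σ))

    adj⇒ : ∀ {x y} → Adj E x y → Adj E′ (σʳ x) (σʳ y)
    adj⇒ (inj₁ e) = inj₁ (edge⇒ e)
    adj⇒ (inj₂ e) = inj₂ (edge⇒ e)

  route-transport : ∀ u v → S′.route (σʳ u) (σʳ v) ≡ map σʳ (S.route u v)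
  route-transport u v =
    let p = mapWalk {E′ = E′} σʳ adj⇒ (S.path u v)
        vertices-p = vertices-mapWalk {E′ = E′} σʳ adj⇒ (S.path u v)
    in trans (sym (S′.route-unique p (subst Unique (sym vertices-p) (Unique.map⁺ σʳ-injective (S.path-isPath u v)))))
             vertices-p

  side-transport : ∀ a b → S′.side (σʳ a) (σʳ b) ≡ relabelSubset σ (S.side a b)
  side-transport a b = ⊆-antisym
    (λ {v} v∈ → ∈-relabelSubset⁺ σ (S.∈side⁺ λ b∈ →
      S′.∈side⁻ v∈ (subst (λ z → σʳ b ∈ₗ S′.route z (σʳ a)) (inverseʳ σ)
                     (subst (σʳ b ∈ₗ_) (sym (route-transport (σˡ v) a)) (∈-map⁺ σʳ b∈)))))
    (λ {v} v∈ → S′.∈side⁺ λ b∈ →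
      S.∈side⁻ (∈-relabelSubset⁻ σ v∈)
        (unmap (subst (σʳ b ∈ₗ_) (route-transport (σˡ v) a)
                 (subst (λ z → σʳ b ∈ₗ S′.route z (σʳ a)) (sym (inverseʳ σ)) b∈))))
    where
    unmap : ∀ {x xs} → σʳ x ∈ₗ map σʳ xs → x ∈ₗ xs
    unmap x∈ = let y , y∈ , eq = ∈-map⁻ σʳ x∈ in subst (_∈ₗ _) (sym (σʳ-injective eq)) y∈

  size-transport : ∀ a b → H′.size (σʳ a) (σʳ b) ≡ H.size a b
  size-transport a b = trans (cong ∣_∣ (side-transport a b)) (∣relabelSubset∣ σ (S.side a b))

  Toward⇒ : ∀ {a b} → H.Toward a b → H′.Toward (σʳ a) (σʳ b)
  Toward⇒ {a} {b} (inj₁ (e , le)) = inj₁ (edge⇒ e , subst₂ _≤_ (sym (size-transport a b)) (sym (size-transport b a)) le)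
  Toward⇒ {a} {b} (inj₂ (e , lt)) = inj₂ (edge⇒ e , subst₂ _<_ (sym (size-transport a b)) (sym (size-transport b a)) lt)

  Toward⇐ : ∀ {a w} → H′.Toward (σʳ a) w → H.Toward a (σˡ w)
  Toward⇐ {a} {w} a→w with subst (H′.Toward (σʳ a)) (sym (inverseʳ σ)) a→w
  ... | inj₁ (e , le) = inj₁ (edge⇐ e , subst₂ _≤_ (size-transport a (σˡ w)) (size-transport (σˡ w) a) le)
  ... | inj₂ (e , lt) = inj₂ (edge⇐ e , subst₂ _<_ (size-transport a (σˡ w)) (size-transport (σˡ w) a) lt)

  IsSink⇒ : ∀ {c} → H.IsSink c → H′.IsSink (σʳ c)
  IsSink⇒ c-sink w c→w = c-sink (σˡ w) (Toward⇐ c→w)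

  induced-transport : ∀ X → induced E′ (relabelSubset σ X) ≡ relabelDigraph σ (induced E X)
  induced-transport X = digraph-ext to from
    where
    to : ∀ u v → Edge (induced E′ (relabelSubset σ X)) u v → Edge (relabelDigraph σ (induced E X)) u v
    to u v e with edge-induced⁻ E′ (relabelSubset σ X) e
    ... | u∈ , v∈ , e′ = edge-relabel⁺ σ (induced E X)
      (edge-induced⁺ E X (∈-relabelSubset⁻ σ u∈) (∈-relabelSubset⁻ σ v∈)
        (edge⇐ (subst₂ (Edge E′) (sym (inverseʳ σ)) (sym (inverseʳ σ)) e′)))
    from : ∀ u v → Edge (relabelDigraph σ (induced E X)) u v → Edge (induced E′ (relabelSubset σ X)) u v
    from u v e with edge-induced⁻ E X (edge-relabel⁻ σ (induced E X) e)
    ... | u∈ , v∈ , e′ = edge-induced⁺ E′ (relabelSubset σ X) (∈-relabelSubset⁺ σ u∈) (∈-relabelSubset⁺ σ v∈)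
      (subst₂ (Edge E′) (inverseʳ σ) (inverseʳ σ) (edge⇒ e′))

  cut-transport : ∀ {a b} (e : Edge E a b) (e′ : Edge E′ (σʳ a) (σʳ b)) →
                  proj₁ (cut T′ e′) ≡ relabel 𝔬+𝒪² σ (proj₁ (cut T e))
  cut-transport {a} {b} _ _
    rewrite side-transport a b | sym (relabelSubset-⊤─ σ (S.side a b))
          | induced-transport (S.side a b) | induced-transport (⊤ ─ S.side a b) = refl

  cutToward-transport : ∀ {r w} (t : H.Toward r w) → proj₁ (cutToward T′ (Toward⇒ t)) ≡ relabel 𝔬+𝒪² σ (proj₁ (cutToward T t))
  cutToward-transport (inj₁ (e , _)) = cut-transport e (edge⇒ e)
  cutToward-transport (inj₂ (e , _)) = cut-transport e (edge⇒ e)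

  classify-transport : E′ ≡ relabelDigraph σ E →
                       ∀ {r} (d : H.IsSink r ⊎ ∃ (H.Toward r)) (d′ : H′.IsSink (σʳ r) ⊎ ∃ (H′.Toward (σʳ r))) →
                       proj₁ (classify T′ d′) ≡ relabel 𝔬+𝒪² σ (proj₁ (classify T d))
  classify-transport E′≡ (inj₁ r-sink) d′ = trans (classify-sink T′ d′ (IsSink⇒ r-sink)) (cong inj₁ E′≡)
  classify-transport _   (inj₂ (_ , t)) d′ = trans (classify-step T′ d′ (Toward⇒ t)) (cutToward-transport t)

-- Rooting at the endpoint on the lighter side (a on a tie) makes a → b the Toward-edge of the root,
-- so that cutting it recovers the pair.
graftRoot : ∀ {n} → Subset n → Fin n → Fin n → Fin n
graftRoot U a b with ∣ U ∣ ≤? ∣ ⊤ ─ U ∣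
... | yes _ = a
... | no  _ = b

graftRoot-≤ : ∀ {n} {U : Subset n} {a b} → ∣ U ∣ ≤ ∣ ⊤ ─ U ∣ → graftRoot U a b ≡ a
graftRoot-≤ {U = U} le with ∣ U ∣ ≤? ∣ ⊤ ─ U ∣
... | yes _ = refl
... | no  ≰ = ⊥-elim (≰ le)

graftRoot-≰ : ∀ {n} {U : Subset n} {a b} → ¬ ∣ U ∣ ≤ ∣ ⊤ ─ U ∣ → graftRoot U a b ≡ b
graftRoot-≰ {U = U} ≰ with ∣ U ∣ ≤? ∣ ⊤ ─ U ∣
... | yes le = ⊥-elim (≰ le)
... | no  _  = refl

toSum : ∀ n → 𝒪 ⟦ n ⟧ → 𝔬+𝒪² ⟦ n ⟧
toSum n ((E , r) , T , _) = classify T (Heavier.sink-or-step T r)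

fromSum : ∀ n → 𝔬+𝒪² ⟦ n ⟧ → 𝒪 ⟦ n ⟧
fromSum n (inj₁ E , T) = (E , proj₁ (Heavier.sink T)) , T , ∈⊤
fromSum n (inj₂ (U , (E₁ , a) , (E₂ , b)) , _ , (T₁ , a∈) , (T₂ , b∈)) =
  (graft E₁ E₂ a b , graftRoot U a b) , Graft.graft-isTree U E₁ E₂ a b T₁ T₂ a∈ b∈ , ∈⊤

fromSum∘toSum : ∀ n (x : 𝒪 ⟦ n ⟧) → proj₁ (fromSum n (toSum n x)) ≡ proj₁ x
fromSum∘toSum n ((E , r) , T , _) with Heavier.sink-or-step T r
... | inj₁ r-sink = cong (E ,_) (sink-unique (proj₂ sink) r-sink)
  where open Heavier T
... | inj₂ (w , inj₁ (e , le)) = cong₂ _,_ (graft-sides T e)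
  (graftRoot-≤ (subst (size r w ≤_) (cong ∣_∣ (sym (⊤─side (inj₁ e)))) le))
  where open Sides T; open Heavier T
... | inj₂ (w , inj₂ (e , lt)) = cong₂ _,_ (graft-sides T e)
  (graftRoot-≰ λ le → ℕ.<⇒≱ lt (subst (size w r ≤_) (cong ∣_∣ (⊤─side (inj₁ e))) le))
  where open Sides T; open Heavier T

module _ {n} (U : Subset n) (E₁ E₂ : Digraph n) (a b : Fin n)
  (T₁ : IsOrientedTree n U E₁) (T₂ : IsOrientedTree n (⊤ ─ U) E₂) (a∈ : a ∈ U) (b∈ : b ∈ ⊤ ─ U) where
  open Graft U E₁ E₂ a b T₁ T₂ a∈ b∈
  open Sides graft-isTree using (⊤─side)
  open Heavier graft-isTree using (size; Toward; sink-or-step)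

  cut-graft : ∀ (e : Edge (graft E₁ E₂ a b) a b) → proj₁ (cut graft-isTree e) ≡ inj₂ (U , (E₁ , a) , (E₂ , b))
  cut-graft e rewrite side-graft | induced-graft₁ | induced-graft₂ = refl

  size-graft-ab : size a b ≡ ∣ U ∣
  size-graft-ab = cong ∣_∣ side-graft

  size-graft-ba : size b a ≡ ∣ ⊤ ─ U ∣
  size-graft-ba = cong ∣_∣ (trans (sym (⊤─side (inj₁ edge-ab))) (cong (⊤ ─_) side-graft))

  classify-graftRoot : proj₁ (classify graft-isTree (sink-or-step (graftRoot U a b))) ≡ inj₂ (U , (E₁ , a) , (E₂ , b))
  classify-graftRoot with ∣ U ∣ ≤? ∣ ⊤ ─ U ∣
  ... | yes le =
    trans (classify-step graft-isTree (sink-or-step a) a→b) (cut-graft edge-ab)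
    where
    a→b : Toward a b
    a→b = inj₁ (edge-ab , subst₂ _≤_ (sym size-graft-ab) (sym size-graft-ba) le)
  ... | no ≰ =
    trans (classify-step graft-isTree (sink-or-step b) b→a) (cut-graft edge-ab)
    where
    b→a : Toward b a
    b→a = inj₂ (edge-ab , subst₂ _<_ (sym size-graft-ba) (sym size-graft-ab) (ℕ.≰⇒> ≰))

toSum∘fromSum : ∀ n (y : 𝔬+𝒪² ⟦ n ⟧) → proj₁ (toSum n (fromSum n y)) ≡ proj₁ y
toSum∘fromSum n (inj₁ E , T) = classify-sink T (sink-or-step (proj₁ sink)) (proj₂ sink)
  where open Heavier T
toSum∘fromSum n (inj₂ (U , (E₁ , a) , (E₂ , b)) , _ , (T₁ , a∈) , (T₂ , b∈)) =
  classify-graftRoot U E₁ E₂ a b T₁ T₂ a∈ b∈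

relabel-id : ∀ {n} (z : Raw 𝔬+𝒪² n) → relabel 𝔬+𝒪² Perm.id z ≡ z
relabel-id (inj₁ E) = cong inj₁ (relabelDigraph-id E)
relabel-id (inj₂ (U , (E₁ , a) , (E₂ , b)))
  rewrite relabelSubset-id U | relabelDigraph-id E₁ | relabelDigraph-id E₂ = refl

toSum-natural : ∀ n (σ : Permutation′ n) (x y : 𝒪 ⟦ n ⟧) → proj₁ y ≡ relabel 𝒪 σ (proj₁ x) →
                proj₁ (toSum n y) ≡ relabel 𝔬+𝒪² σ (proj₁ (toSum n x))
toSum-natural n σ ((E , r) , T , _) ((_ , _) , T′ , _) refl =
  classify-transport refl (Heavier.sink-or-step T r) (Heavier.sink-or-step T′ (σ ⟨$⟩ʳ r))
  where open Transport T T′ σ (edge-relabel σ E) (edge-unrelabel σ E)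

toSum-cong : ∀ n (x y : 𝒪 ⟦ n ⟧) → proj₁ x ≡ proj₁ y → proj₁ (toSum n x) ≡ proj₁ (toSum n y)
toSum-cong n ((E , r) , T , _) ((_ , _) , T′ , _) refl =
  sym (trans (classify-transport (sym (relabelDigraph-id E)) (Heavier.sink-or-step T r) (Heavier.sink-or-step T′ r))
             (relabel-id _))
  where open Transport T T′ Perm.id id id

fromSum-cong : ∀ n (x y : 𝔬+𝒪² ⟦ n ⟧) → proj₁ x ≡ proj₁ y → proj₁ (fromSum n x) ≡ proj₁ (fromSum n y)
fromSum-cong n (inj₁ E , T) (inj₁ _ , T′) refl =
  cong (E ,_) (Heavier.sink-unique T′ (IsSink⇒ (proj₂ (Heavier.sink T))) (proj₂ (Heavier.sink T′)))
  where open Transport T T′ Perm.id id id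
fromSum-cong n (inj₂ _ , _) (inj₂ _ , _) refl = refl

mainTheorem16 : NatIso 𝒪 (𝔬 +ˢ (𝒪 ·ˢ 𝒪))
mainTheorem16 = record
  { to        = toSum
  ; from      = fromSum
  ; to-cong   = toSum-cong
  ; from-cong = fromSum-cong
  ; from-to   = fromSum∘toSum
  ; to-from   = toSum∘fromSum
  ; natural   = toSum-natural
  }
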